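{- There is an algorithm which, given two synchronized automata (in the Fibonacci numeration system) computing sequences $(s(n))_{n\ge0}$ and $(s'(n))_{n\ge 0}$ of natural numbers, decides whether $(s'(n))$ is the distinctness transform of $(s(n))$.
   Context: $\mathbb{N}=\{0,1,2,\ldots\}$. Fibonacci numbers: $F_0=0$, $F_1=1$, $F_n=F_{n-1}+F_{n-2}$. Every $n\in\mathbb{N}$ is written uniquely (Zeckendorf representation) as a bit string $(n)_F=e_1\cdots e_t$ with $e_1\ne 0$, no two consecutive $1$'s, and $n=\sum_{i} e_iF_{t-i+2}$; leading zeros are allowed and ignored. A function $f:\mathbb{N}\to\mathbb{N}$ is synchronized if there is a deterministic finite automaton reading the Fibonacci representations of a pair $(n,x)$ in parallel (the shorter one padded with leading zeros) that accepts if and only if $x=f(n)$. The distinctness transform of a sequence $(s(n))_{n\ge0}$ of natural numbers is the sequence obtained by scanning $s(0),s(1),s(2),\ldots$ from left to right and deleting every term whose value already occurred earlier in the sequence. -}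

module Defs where

open import Data.Nat using (ℕ; zero; suc; _+_; _∸_; _⊔_; _<_; _≟_)
open import Data.Bool using (Bool; true; false; if_then_else_)
open import Data.Fin using (Fin)
open import Data.List using (List; []; _∷_; length; replicate; _++_)
open import Data.Product using (Σ; ∃; _×_; _,_)
open import Relation.Binary.PropositionalEquality using (_≡_)
open import Relation.Nullary using (¬_; yes; no)
open import Data.Unit using (⊤)
open import Data.Empty using (⊥)
open import Function.Bundles using (_⇔_)

fib : ℕ → ℕ
fib zero = 0
fib (suc zero) = 1
fib (suc (suc n)) = fib (suc n) + fib n

-- Bit strings, most significant bit first (true = 1, false = 0).
-- value e_1 ⋯ e_t = Σ_i e_i F_{t-i+2}
fibValue : List Bool → ℕ
fibValue [] = 0
fibValue (b ∷ w) = (if b then fib (length w + 2) else 0) + fibValue w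

NoConsecOnes : List Bool → Set
NoConsecOnes [] = ⊤
NoConsecOnes (true ∷ true ∷ w) = ⊥
NoConsecOnes (b ∷ w) = NoConsecOnes w

-- first bit is nonzero (the empty string is the canonical representation of 0)
NoLeadingZero : List Bool → Set
NoLeadingZero [] = ⊤
NoLeadingZero (b ∷ w) = b ≡ true

IsZeck : List Bool → ℕ → Set
IsZeck w n = NoLeadingZero w × NoConsecOnes w × fibValue w ≡ n

record DFA : Set where
  field
    Q      : ℕ
    start  : Fin Q
    δ      : Fin Q → Bool → Bool → Fin Q
    final  : Fin Q → Bool

pad : ℕ → List Bool → List Bool
pad m w = replicate (m ∸ length w) false ++ w

runDFA : (A : DFA) → Fin (DFA.Q A) → List Bool → List Bool → Fin (DFA.Q A)
runDFA A q (a ∷ u) (b ∷ v) = runDFA A (DFA.δ A q a b) u v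
runDFA A q _ _ = q

accepts : DFA → List Bool → List Bool → Bool
accepts A w w' =
  DFA.final A (runDFA A (DFA.start A) (pad L w) (pad L w'))
  where L = length w ⊔ length w'

Synchronized : DFA → (ℕ → ℕ) → Set
Synchronized A f =
  ∀ n x w w' → IsZeck w n → IsZeck w' x → (accepts A w w' ≡ true ⇔ x ≡ f n)

FirstOcc : (ℕ → ℕ) → ℕ → Set
FirstOcc s i = ∀ j → j < i → ¬ (s j ≡ s i)

occursBefore : (ℕ → ℕ) → ℕ → ℕ → Bool
occursBefore s v zero = false
occursBefore s v (suc j) with s j ≟ v
... | yes _ = true
... | no _ = occursBefore s v j

countNew : (ℕ → ℕ) → ℕ → ℕ
countNew s zero = 0
countNew s (suc i) =
  (if occursBefore s (s i) i then 0 else 1) + countNew s i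

-- s' is the distinctness transform of s: the k-th term of s' is the value
-- of s at the k-th (0-based) index whose value has not occurred earlier
-- (this in particular requires s to take infinitely many distinct values,
-- since s' is an infinite sequence).
IsDistinctnessTransform : (ℕ → ℕ) → (ℕ → ℕ) → Set
IsDistinctnessTransform s s' =
  ∀ k → ∃ λ i → FirstOcc s i × countNew s i ≡ k × s' k ≡ s i

-- s' is the distinctness transform of s iff (1) every value of s occurs in s', (2) every value of s'
-- occurs in s, and (3) for k < k' the value s' k occurs in s before any occurrence of s' k'; then the
-- k-th term of s' sits at the k-th first occurrence in s.  Each condition is a ∀∃-statement about the
-- graphs of s and s' and the order <, which automata recognize on Fibonacci representations read in
-- parallel.  Such a statement is decidable: pad the universal tracks with leading zeros, project the
-- existential tracks away by the subset construction, and test the result for universality, which by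
-- cutting loops only requires inspecting words no longer than the number of states.

module Submission where

open import Defs
open import Data.Nat as ℕ
  using (ℕ; zero; suc; _+_; _∸_; _≤_; _<_; z≤n; s≤s; _⊔_; _⊓_; _≤?_; _≤′_; ≤′-refl; ≤′-step)
open import Data.Nat.Properties hiding (_≟_)
open import Data.Nat.Induction using (<-rec)
open import Data.Bool using (Bool; true; false; T; not; _∧_; _∨_)
open import Data.Bool.Properties using (T-∧; T-∨; T-≡; T?)
open import Data.Bool.ListAction using (any)
open import Data.Fin as Fin using (Fin; toℕ)
open import Data.Fin.Properties using (pigeonhole; toℕ<n; ∀-cons-⇔)
open import Data.Maybe using (Maybe; just; nothing; is-just; fromMaybe; maybe)
open import Data.List as List
  using (List; []; _∷_; _++_; length; map; replicate; foldl; take; drop; dropWhileᵇ; allFin; cartesianProduct; cartesianProductWith)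
open import Data.List.Properties
  using (foldl-++; map-∘; map-id; map-replicate; map-++; map-cong; length-map; length-replicate; length-++; length-take; length-drop;
         take++drop≡id)
open import Data.List.Membership.Propositional using (_∈_)
open import Data.List.Membership.Propositional.Properties
  using (∈-allFin; ∈-map⁺; ∈-cartesianProduct⁺; ∈-cartesianProductWith⁺)
open import Data.List.Relation.Unary.Any as Any using (here; there)
import Data.List.Relation.Unary.Any.Properties as Anyₚ
open import Data.Vec as Vec using (Vec; []; _∷_; tabulate)
open import Data.Vec.Properties using (lookup∘tabulate; lookup-replicate)
open import Data.Product using (Σ; ∃; ∃₂; _×_; _,_; proj₁; proj₂; <_,_>; uncurry)
open import Data.Product.Function.NonDependent.Propositional using (_×-⇔_)
open import Data.Sum using (_⊎_; inj₁; inj₂; [_,_])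
open import Data.Empty using (⊥-elim)
open import Data.Unit using (⊤; tt)
open import Function using (_∘_; id)
open import Function.Bundles using (_⇔_; mk⇔; Equivalence)
import Function.Properties.Equivalence as ⇔
import Relation.Binary.Reasoning.Setoid as SetoidReasoning
open import Level using (0ℓ)
open import Function.Related.TypeIsomorphisms using (→-cong-⇔)
open import Relation.Binary.Definitions using (DecidableEquality; tri<; tri≈; tri>)
open import Relation.Binary.PropositionalEquality using (_≡_; refl; sym; trans; cong; cong₂; subst; subst₂; module ≡-Reasoning)
open import Relation.Nullary using (¬_; yes; no; Dec)
open import Relation.Nullary.Decidable using (isYes; toWitness; fromWitness; _×-dec_)
import Relation.Nullary.Decidable as Dec

open Equivalence using (to; from)

record Enumeration (A : Set) : Set where
  field
    elements : List A
    complete : ∀ x → x ∈ elements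

  size : ℕ
  size = length elements

  index : A → Fin size
  index x = Any.index (complete x)

  lookup-index : ∀ x → List.lookup elements (index x) ≡ x
  lookup-index x = sym (Anyₚ.lookup-index (complete x))

  index-injective : ∀ {x y} → index x ≡ index y → x ≡ y
  index-injective {x} {y} eq =
    trans (sym (lookup-index x)) (trans (cong (List.lookup elements) eq) (lookup-index y))

  _≟_ : DecidableEquality A
  x ≟ y = Dec.map′ index-injective (cong index) (index x Fin.≟ index y)

  T-any : (p : A → Bool) → T (any p elements) ⇔ ∃ λ x → T (p x)
  T-any p = mk⇔ (Any.satisfied ∘ Anyₚ.any⁻ p elements)
                (λ (x , px) → Anyₚ.any⁺ p (Any.map (λ { refl → px }) (complete x)))

  Subset : Set
  Subset = Vec Bool size

  _∋_ : Subset → A → Bool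
  P ∋ x = Vec.lookup P (index x)

  subset : (A → Bool) → Subset
  subset p = tabulate (p ∘ List.lookup elements)

  subset-∋ : ∀ p x → subset p ∋ x ≡ p x
  subset-∋ p x = trans (lookup∘tabulate _ (index x)) (cong p (lookup-index x))

open Enumeration using (elements; complete; size; index; index-injective; T-any)

bool-enumeration : Enumeration Bool
bool-enumeration = record
  { elements = true ∷ false ∷ []
  ; complete = λ { true → here refl ; false → there (here refl) } }

fin-enumeration : ∀ n → Enumeration (Fin n)
fin-enumeration n = record { elements = allFin n ; complete = ∈-allFin }

maybe-enumeration : {A : Set} → Enumeration A → Enumeration (Maybe A)
maybe-enumeration E = record
  { elements = nothing ∷ map just (elements E)
  ; complete = λ { nothing → here refl ; (just x) → there (∈-map⁺ just (complete E x)) } }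

product-enumeration : {A B : Set} → Enumeration A → Enumeration B → Enumeration (A × B)
product-enumeration E F = record
  { elements = cartesianProduct (elements E) (elements F)
  ; complete = λ (x , y) → ∈-cartesianProduct⁺ (complete E x) (complete F y) }

vec-enumeration : {A : Set} → Enumeration A → ∀ n → Enumeration (Vec A n)
vec-enumeration E zero = record { elements = [] ∷ [] ; complete = λ { [] → here refl } }
vec-enumeration E (suc n) = record
  { elements = cartesianProductWith _∷_ (elements E) (elements (vec-enumeration E n))
  ; complete = λ { (x ∷ xs) → ∈-cartesianProductWith⁺ _∷_ (complete E x) (complete (vec-enumeration E n) xs) } }

T-not : ∀ {x} → T (not x) ⇔ (¬ T x)
T-not {false} = mk⇔ (λ _ ()) (λ _ → tt)
T-not {true} = mk⇔ (λ ()) (λ ¬t → ¬t tt)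

T-⇒ : ∀ {x y} → T (not x ∨ y) ⇔ (T x → T y)
T-⇒ {false} = mk⇔ (λ _ ()) (λ _ → tt)
T-⇒ {true} = mk⇔ (λ t _ → t) (λ f → f tt)

record Automaton (L : Set) : Set₁ where
  field
    State     : Set
    states    : Enumeration State
    initial   : State
    step      : State → L → State
    accepting : State → Bool

  run : State → List L → State
  run = foldl step

  accepts? : List L → Bool
  accepts? w = accepting (run initial w)

open Automaton

module _ {L : Set} where

  product : (Bool → Bool → Bool) → Automaton L → Automaton L → Automaton L
  product op A B = record
    { State = State A × State B
    ; states = product-enumeration (states A) (states B)
    ; initial = initial A , initial B
    ; step = λ (p , q) a → step A p a , step B q a
    ; accepting = λ (p , q) → op (accepting A p) (accepting B q) }

  run-product : ∀ op A B p q w → run (product op A B) (p , q) w ≡ (run A p w , run B q w)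
  run-product op A B p q [] = refl
  run-product op A B p q (a ∷ w) = run-product op A B (step A p a) (step B q a) w

  accepts?-product : ∀ op A B w → accepts? (product op A B) w ≡ op (accepts? A w) (accepts? B w)
  accepts?-product op A B w = cong (accepting (product op A B)) (run-product op A B _ _ w)

  _∩_ _⇒_ : Automaton L → Automaton L → Automaton L
  _∩_ = product _∧_
  _⇒_ = product (λ x y → not x ∨ y)

  T-accepts?-∩ : ∀ A B w → T (accepts? (A ∩ B) w) ⇔ (T (accepts? A w) × T (accepts? B w))
  T-accepts?-∩ A B w rewrite accepts?-product _∧_ A B w = T-∧

  T-accepts?-⇒ : ∀ A B w → T (accepts? (A ⇒ B) w) ⇔ (T (accepts? A w) → T (accepts? B w))
  T-accepts?-⇒ A B w rewrite accepts?-product (λ x y → not x ∨ y) A B w = T-⇒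

  complement : Automaton L → Automaton L
  complement A = record A { accepting = not ∘ accepting A }

  comap : {L' : Set} → (L → L') → Automaton L' → Automaton L
  comap f A = record
    { State = State A ; states = states A ; initial = initial A
    ; step = λ q a → step A q (f a) ; accepting = accepting A }

  run-comap : ∀ {L'} (f : L → L') A q w → run (comap f A) q w ≡ run A q (map f w)
  run-comap f A q [] = refl
  run-comap f A q (a ∷ w) = run-comap f A (step A q (f a)) w

  accepts?-comap : ∀ {L'} (f : L → L') A w → accepts? (comap f A) w ≡ accepts? A (map f w)
  accepts?-comap f A w = cong (accepting A) (run-comap f A (initial A) w)

module Emptiness {L : Set} (letters : Enumeration L) (A : Automaton L) where
  private
    M : ℕ
    M = size (states A)

  -- Among the M + 1 prefixes of length ≤ M two reach the same state; cut out the loop between them.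
  cut-loop : ∀ q w → M < length w → ∃ λ w' → length w' < length w × run A q w' ≡ run A q w
  cut-loop q w M<|w| with pigeonhole ≤-refl (λ (i : Fin (suc M)) → index (states A) (run A q (take (toℕ i) w)))
  ... | i , j , i<j , same-index = take (toℕ i) w ++ drop (toℕ j) w , shorter , same-state
    where
      j≤|w| : toℕ j ≤ length w
      j≤|w| = ≤-trans (≤-pred (toℕ<n j)) (<⇒≤ M<|w|)
      shorter : length (take (toℕ i) w ++ drop (toℕ j) w) < length w
      shorter = begin-strict
        length (take (toℕ i) w ++ drop (toℕ j) w)
          ≡⟨ length-++ (take (toℕ i) w) ⟩
        length (take (toℕ i) w) + length (drop (toℕ j) w)
          ≡⟨ cong₂ _+_ (length-take (toℕ i) w) (length-drop (toℕ j) w) ⟩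
        toℕ i ⊓ length w + (length w ∸ toℕ j)
          ≤⟨ +-monoˡ-≤ _ (m⊓n≤m (toℕ i) (length w)) ⟩
        toℕ i + (length w ∸ toℕ j)
          <⟨ +-monoˡ-< _ i<j ⟩
        toℕ j + (length w ∸ toℕ j)
          ≡⟨ m+[n∸m]≡n j≤|w| ⟩
        length w ∎
        where open ≤-Reasoning
      same-state : run A q (take (toℕ i) w ++ drop (toℕ j) w) ≡ run A q w
      same-state = begin
        run A q (take (toℕ i) w ++ drop (toℕ j) w)
          ≡⟨ foldl-++ (step A) q (take (toℕ i) w) _ ⟩
        run A (run A q (take (toℕ i) w)) (drop (toℕ j) w)
          ≡⟨ cong (λ p → run A p (drop (toℕ j) w)) (index-injective (states A) same-index) ⟩
        run A (run A q (take (toℕ j) w)) (drop (toℕ j) w)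
          ≡⟨ foldl-++ (step A) q (take (toℕ j) w) _ ⟨
        run A q (take (toℕ j) w ++ drop (toℕ j) w)
          ≡⟨ cong (run A q) (take++drop≡id (toℕ j) w) ⟩
        run A q w ∎
        where open ≡-Reasoning

  short-word : ∀ q n w → length w ≤ n → ∃ λ w' → length w' ≤ M × run A q w' ≡ run A q w
  short-word q n w |w|≤n with length w ≤? M
  ... | yes |w|≤M = w , |w|≤M , refl
  short-word q zero w |w|≤n | no |w|≰M = ⊥-elim (|w|≰M (≤-trans |w|≤n z≤n))
  short-word q (suc n) w |w|≤n | no |w|≰M with cut-loop q w (≰⇒> |w|≰M)
  ... | w' , shorter , same with short-word q n w' (≤-pred (≤-trans shorter |w|≤n))
  ... | w'' , bounded , same' = w'' , bounded , trans same' same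

  acceptsWithin : ℕ → State A → Bool
  acceptsWithin zero q = accepting A q
  acceptsWithin (suc n) q = accepting A q ∨ any (λ a → acceptsWithin n (step A q a)) (elements letters)

  T-acceptsWithin : ∀ n q → T (acceptsWithin n q) ⇔ ∃ λ w → length w ≤ n × T (accepting A (run A q w))
  T-acceptsWithin n q = mk⇔ (found n q) (search n q)
    where
      found : ∀ n q → T (acceptsWithin n q) → ∃ λ w → length w ≤ n × T (accepting A (run A q w))
      found zero q acc = [] , z≤n , acc
      found (suc n) q acc with to T-∨ acc
      ... | inj₁ acc' = [] , z≤n , acc'
      ... | inj₂ later with to (T-any letters _) later
      ... | a , acc' with found n (step A q a) acc'
      ... | w , |w|≤n , acc'' = a ∷ w , s≤s |w|≤n , acc''
      search : ∀ n q → (∃ λ w → length w ≤ n × T (accepting A (run A q w))) → T (acceptsWithin n q)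
      search zero q ([] , _ , acc) = acc
      search (suc n) q ([] , _ , acc) = from T-∨ (inj₁ acc)
      search (suc n) q (a ∷ w , s≤s |w|≤n , acc) =
        from T-∨ (inj₂ (from (T-any letters _) (a , search n (step A q a) (w , |w|≤n , acc))))

  nonempty? : Bool
  nonempty? = acceptsWithin M (initial A)

  T-nonempty? : T nonempty? ⇔ ∃ λ w → T (accepts? A w)
  T-nonempty? = mk⇔ (λ t → let w , _ , acc = to (T-acceptsWithin M (initial A)) t in w , acc) shortened
    where
      shortened : (∃ λ w → T (accepts? A w)) → T nonempty?
      shortened (w , acc) with short-word (initial A) (length w) w ≤-refl
      ... | w' , bounded , same = from (T-acceptsWithin M (initial A)) (w' , bounded , subst (T ∘ accepting A) (sym same) acc)

open Emptiness using (nonempty?; T-nonempty?)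

universal? : {L : Set} → Enumeration L → Automaton L → Bool
universal? letters A = not (nonempty? letters (complement A))

T-universal? : {L : Set} (letters : Enumeration L) (A : Automaton L) → T (universal? letters A) ⇔ ∀ w → T (accepts? A w)
T-universal? letters A = mk⇔ everywhere nowhere-rejected
  where
    everywhere : T (universal? letters A) → ∀ w → T (accepts? A w)
    everywhere t w with T? (accepts? A w)
    ... | yes acc = acc
    ... | no rej = ⊥-elim (to T-not t (from (T-nonempty? letters (complement A)) (w , from T-not rej)))
    nowhere-rejected : (∀ w → T (accepts? A w)) → T (universal? letters A)
    nowhere-rejected all-acc = from T-not λ t →
      let w , rej = to (T-nonempty? letters (complement A)) t in to T-not rej (all-acc w)

module _ {X Y : Set} where

  length-map-proj : ∀ (W : List (X × Y)) → length (map proj₁ W) ≡ length (map proj₂ W)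
  length-map-proj W = trans (length-map proj₁ W) (sym (length-map proj₂ W))

  map-proj₁-pad : ∀ (x : X) (ys : List Y) → map proj₁ (map (x ,_) ys) ≡ replicate (length ys) x
  map-proj₁-pad x [] = refl
  map-proj₁-pad x (y ∷ ys) = cong (x ∷_) (map-proj₁-pad x ys)

  map-proj₁-≡-replicate : ∀ {x : X} k (W : List (X × Y)) → map proj₁ W ≡ replicate k x →
                          W ≡ map (x ,_) (map proj₂ W)
  map-proj₁-≡-replicate k [] _ = refl
  map-proj₁-≡-replicate (suc k) ((x , y) ∷ W) eq with cong List.head eq
  ... | refl = cong ((x , y) ∷_) (map-proj₁-≡-replicate k W (cong (drop 1) eq))

  map-proj₁-≡-++ : ∀ (U V : List X) (W : List (X × Y)) → map proj₁ W ≡ U ++ V →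
                   ∃₂ λ W₁ W₂ → W ≡ W₁ ++ W₂ × map proj₁ W₁ ≡ U × map proj₁ W₂ ≡ V
  map-proj₁-≡-++ [] V W eq = [] , W , refl , refl , eq
  map-proj₁-≡-++ (u ∷ U) V ((x , y) ∷ W) eq with cong List.head eq
  ... | refl with map-proj₁-≡-++ U V W (cong (drop 1) eq)
  ... | W₁ , W₂ , refl , eq₁ , eq₂ = (x , y) ∷ W₁ , W₂ , refl , cong (x ∷_) eq₁ , eq₂

-- The subset construction projecting away the Y-track; ∀∃? decides whether every u, padded with
-- leading blanks, extends to a word accepted by A.
module Projection {X Y : Set} (Xs : Enumeration X) (Ys : Enumeration Y) (blank : X) (A : Automaton (X × Y)) where
  open Enumeration (states A) using (Subset; _∋_; subset; subset-∋; _≟_)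

  hitting : State A → Automaton (X × Y)
  hitting t = record A { accepting = λ q → isYes (q ≟ t) }

  reaching : State A → Automaton Y
  reaching t = comap (blank ,_) (hitting t)

  reachable? : State A → Bool
  reachable? t = nonempty? Ys (reaching t)

  T-reachable? : ∀ t → T (reachable? t) ⇔ ∃ λ ys → run A (initial A) (map (blank ,_) ys) ≡ t
  T-reachable? t = mk⇔
    (λ r → let ys , at-t = to (T-nonempty? Ys (reaching t)) r
           in ys , toWitness (subst (λ q → T (isYes (q ≟ t))) (run-comap (blank ,_) (hitting t) (initial A) ys) at-t))
    (λ (ys , at-t) → from (T-nonempty? Ys (reaching t))
           (ys , subst (λ q → T (isYes (q ≟ t))) (sym (run-comap (blank ,_) (hitting t) (initial A) ys))
                       (fromWitness at-t)))

  steps-to? : X → State A → State A → Bool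
  steps-to? x q q' = any (λ y → isYes (step A q (x , y) ≟ q')) (elements Ys)

  T-steps-to? : ∀ x q q' → T (steps-to? x q q') ⇔ ∃ λ y → step A q (x , y) ≡ q'
  T-steps-to? x q q' = ⇔.trans (T-any Ys (λ y → isYes (step A q (x , y) ≟ q')))
                               (mk⇔ (λ (y , t) → y , toWitness t) (λ (y , eq) → y , fromWitness eq))

  successor? : Subset → X → State A → Bool
  successor? P x q' = any (λ q → P ∋ q ∧ steps-to? x q q') (elements (states A))

  successors : Subset → X → Subset
  successors P x = subset (successor? P x)

  T-successors : ∀ P x q' → T (successors P x ∋ q') ⇔ ∃ λ q → T (P ∋ q) × ∃ λ y → step A q (x , y) ≡ q'
  T-successors P x q' =
    subst (λ b → T b ⇔ _) (sym (subset-∋ (successor? P x) q'))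
      (⇔.trans (T-any (states A) (λ q → P ∋ q ∧ steps-to? x q q'))
               (mk⇔ (λ (q , t) → let q∈P , steps = to T-∧ t in q , q∈P , to (T-steps-to? x q q') steps)
                    (λ (q , q∈P , steps) → q , from T-∧ (q∈P , from (T-steps-to? x q q') steps))))

  projection : Automaton X
  projection = record
    { State = Subset
    ; states = vec-enumeration bool-enumeration _
    ; initial = subset reachable?
    ; step = successors
    ; accepting = λ P → any (λ q → P ∋ q ∧ accepting A q) (elements (states A)) }

  T-run-projection : ∀ us P q → T (run projection P us ∋ q) ⇔
                     ∃₂ λ p W → T (P ∋ p) × map proj₁ W ≡ us × run A p W ≡ q
  T-run-projection us P q = mk⇔ (traced us P q) λ { (p , W , p∈P , refl , refl) → tracing W P p p∈P }
    where
      traced : ∀ us P q → T (run projection P us ∋ q) →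
               ∃₂ λ p W → T (P ∋ p) × map proj₁ W ≡ us × run A p W ≡ q
      traced [] P q q∈P = q , [] , q∈P , refl , refl
      traced (u ∷ us) P q q∈ with traced us (successors P u) q q∈
      ... | p' , W , p'∈ , eq , reach with to (T-successors P u p') p'∈
      ... | p , p∈P , y , refl = p , (u , y) ∷ W , p∈P , cong (u ∷_) eq , reach
      tracing : ∀ W P p → T (P ∋ p) → T (run projection P (map proj₁ W) ∋ run A p W)
      tracing [] P p p∈P = p∈P
      tracing ((u , y) ∷ W) P p p∈P =
        tracing W (successors P u) (step A p (u , y)) (from (T-successors P u _) (p , p∈P , y , refl))

  PaddedAcceptance : List X → Set
  PaddedAcceptance us = ∃₂ λ k W → map proj₁ W ≡ replicate k blank ++ us × T (accepts? A W)

  T-accepts?-projection : ∀ us → T (accepts? projection us) ⇔ PaddedAcceptance us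
  T-accepts?-projection us = mk⇔ unfold fold
    where
      start : Subset
      start = initial projection
      unfold : T (accepts? projection us) → PaddedAcceptance us
      unfold acc with to (T-any (states A) _) acc
      ... | q , t with to T-∧ t
      ... | q∈ , q-acc with to (T-run-projection us start q) q∈
      ... | p , W , p∈ , refl , refl with to (T-reachable? p) (subst T (subset-∋ reachable? p) p∈)
      ... | ys , refl =
        length ys , map (blank ,_) ys ++ W ,
        trans (map-++ proj₁ (map (blank ,_) ys) W) (cong (_++ map proj₁ W) (map-proj₁-pad blank ys)) ,
        subst (T ∘ accepting A) (sym (foldl-++ (step A) (initial A) (map (blank ,_) ys) W)) q-acc
      fold : PaddedAcceptance us → T (accepts? projection us)
      fold (k , W , eq , acc) with map-proj₁-≡-++ (replicate k blank) us W eq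
      ... | W₁ , W₂ , refl , eq₁ , refl = from (T-any (states A) _) (q , from T-∧ (q∈ , q-acc))
        where
          p q : State A
          p = run A (initial A) W₁
          q = run A p W₂
          p∈ : T (start ∋ p)
          p∈ = subst T (sym (subset-∋ reachable? p))
                 (from (T-reachable? p)
                       (map proj₂ W₁ , cong (run A (initial A)) (sym (map-proj₁-≡-replicate k W₁ eq₁))))
          q∈ : T (run projection start (map proj₁ W₂) ∋ q)
          q∈ = from (T-run-projection _ start q) (p , W₂ , p∈ , refl , refl)
          q-acc : T (accepting A q)
          q-acc = subst (T ∘ accepting A) (foldl-++ (step A) (initial A) W₁ W₂) acc

  ∀∃? : Bool
  ∀∃? = universal? Xs projection

  T-∀∃? : T ∀∃? ⇔ (∀ us → PaddedAcceptance us)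
  T-∀∃? = mk⇔ (λ t us → to (T-accepts?-projection us) (to (T-universal? Xs projection) t us))
              (λ h → from (T-universal? Xs projection) (λ us → from (T-accepts?-projection us) (h us)))

Represents : List Bool → ℕ → Set
Represents w n = NoConsecOnes w × fibValue w ≡ n

NoConsecOnes-tail : ∀ b w → NoConsecOnes (b ∷ w) → NoConsecOnes w
NoConsecOnes-tail false w nco = nco
NoConsecOnes-tail true [] _ = tt
NoConsecOnes-tail true (false ∷ w) nco = nco

fib-+2 : ∀ n → fib (n + 2) ≡ fib (suc (suc n))
fib-+2 n = cong fib (+-comm n 2)

fib-pos : ∀ n → 1 ≤ fib (suc n)
fib-pos zero = s≤s z≤n
fib-pos (suc n) = ≤-trans (fib-pos n) (m≤m+n (fib (suc n)) (fib n))

fib-≤-suc : ∀ n → fib n ≤ fib (suc n)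
fib-≤-suc zero = z≤n
fib-≤-suc (suc n) = m≤m+n (fib (suc n)) (fib n)

n<fib[n+2] : ∀ n → n < fib (n + 2)
n<fib[n+2] zero = s≤s z≤n
n<fib[n+2] (suc n) = begin-strict
  suc n                           <⟨ s≤s (n<fib[n+2] n) ⟩
  suc (fib (n + 2))               ≤⟨ +-monoˡ-≤ (fib (n + 2)) (fib-pos n) ⟩
  fib (suc n) + fib (n + 2)       ≡⟨ +-comm (fib (suc n)) _ ⟩
  fib (n + 2) + fib (suc n)       ≡⟨ cong (_+ fib (suc n)) (fib-+2 n) ⟩
  fib (suc (suc n)) + fib (suc n) ≡⟨ fib-+2 (suc n) ⟨
  fib (suc n + 2)                 ∎
  where open ≤-Reasoning

fibValue-bound : ∀ w → NoConsecOnes w → fibValue w < fib (length w + 2)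
fibValue-bound [] _ = s≤s z≤n
fibValue-bound (false ∷ w) nco = ≤-trans (fibValue-bound w nco) (fib-≤-suc (length w + 2))
fibValue-bound (true ∷ []) _ = s≤s (s≤s z≤n)
fibValue-bound (true ∷ false ∷ w) nco = +-monoʳ-< (fib (suc (length w + 2))) (fibValue-bound w nco)

RepresentationOfLength : ℕ → ℕ → Set
RepresentationOfLength j n = ∃ λ w → length w ≡ j × Represents w n

-- The greedy step: use the leading digit 1 exactly when n ≥ fib (j + 3).
greedy-step : ∀ j n → n < fib (suc (suc j) + 2) → Dec (n < fib (suc j + 2)) →
              (n < fib (suc j + 2) → RepresentationOfLength (suc j) n) →
              (n ∸ fib (suc j + 2) < fib (j + 2) → RepresentationOfLength j (n ∸ fib (suc j + 2))) →
              RepresentationOfLength (suc (suc j)) n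
greedy-step j n n<F (yes n<F₁) shorter _ with shorter n<F₁
... | w , |w| , nco , val = false ∷ w , cong suc |w| , nco , val
greedy-step j n n<F (no n≮F₁) _ remainder
  with remainder (subst (n ∸ fib (suc j + 2) <_) (m+n∸m≡n (fib (suc j + 2)) (fib (j + 2)))
                        (∸-monoˡ-< n<F (≮⇒≥ n≮F₁)))
... | w , refl , nco , val =
  true ∷ false ∷ w , refl , nco , trans (cong (fib (suc (length w) + 2) +_) val) (m+[n∸m]≡n (≮⇒≥ n≮F₁))

represent-in : ∀ j n → n < fib (j + 2) → RepresentationOfLength j n
represent-in zero zero _ = [] , refl , tt , refl
represent-in zero (suc n) (s≤s ())
represent-in (suc zero) zero _ = false ∷ [] , refl , tt , refl
represent-in (suc zero) (suc zero) _ = true ∷ [] , refl , tt , refl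
represent-in (suc zero) (suc (suc n)) (s≤s (s≤s ()))
represent-in (suc (suc j)) n n<F =
  greedy-step j n n<F (n <? fib (suc j + 2)) (represent-in (suc j) n) (represent-in j (n ∸ fib (suc j + 2)))

represent : ∀ n → ∃ λ w → Represents w n
represent n = let w , _ , rep = represent-in n n (n<fib[n+2] n) in w , rep

Recognizes : Automaton (Bool × Bool) → (ℕ → ℕ → Set) → Set
Recognizes B R = ∀ W → NoConsecOnes (map proj₁ W) → NoConsecOnes (map proj₂ W) →
                 T (accepts? B W) ⇔ R (fibValue (map proj₁ W)) (fibValue (map proj₂ W))

-- State just b: no two consecutive 1's so far and the last digit is b; nothing: failure.
noConsecOnes : Automaton Bool
noConsecOnes = record
  { State = Maybe Bool
  ; states = maybe-enumeration bool-enumeration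
  ; initial = just false
  ; step = λ { (just true) true → nothing ; (just _) b → just b ; nothing _ → nothing }
  ; accepting = is-just }

T-noConsecOnes : ∀ w → T (accepts? noConsecOnes w) ⇔ NoConsecOnes w
T-noConsecOnes w = mk⇔ (valid false w) (accepted false w)
  where
    dead : ∀ w → run noConsecOnes nothing w ≡ nothing
    dead [] = refl
    dead (_ ∷ w) = dead w
    valid : ∀ b w → T (is-just (run noConsecOnes (just b) w)) → NoConsecOnes (b ∷ w)
    valid false [] _ = tt
    valid true [] _ = tt
    valid false (c ∷ w) acc = valid c w acc
    valid true (false ∷ w) acc = valid false w acc
    valid true (true ∷ w) acc with () ← subst (T ∘ is-just) (dead w) acc
    accepted : ∀ b w → NoConsecOnes (b ∷ w) → T (is-just (run noConsecOnes (just b) w))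
    accepted false [] _ = tt
    accepted true [] _ = tt
    accepted false (c ∷ w) nco = accepted c w nco
    accepted true (false ∷ w) nco = accepted false w nco

-- State nothing: the words read so far are equal; just true / just false: the first one is smaller / larger.
lessThan : Automaton (Bool × Bool)
lessThan = record
  { State = Maybe Bool
  ; states = maybe-enumeration bool-enumeration
  ; initial = nothing
  ; step = λ { nothing (false , true) → just true ; nothing (true , false) → just false
             ; nothing _ → nothing ; (just r) _ → just r }
  ; accepting = fromMaybe false }

Compared : Maybe Bool → ℕ → ℕ → Set
Compared nothing m n = m ≡ n
Compared (just true) m n = m < n
Compared (just false) m n = n < m

+-compared : ∀ r c {m n} → Compared r m n → Compared r (c + m) (c + n)
+-compared nothing c eq = cong (c +_) eq
+-compared (just true) c lt = +-monoʳ-< c lt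
+-compared (just false) c lt = +-monoʳ-< c lt

below-leading-one : ∀ u v → length u ≡ length v → NoConsecOnes u → fibValue u < fib (length v + 2) + fibValue v
below-leading-one u v |u|≡|v| nco =
  <-≤-trans (subst (λ l → fibValue u < fib (l + 2)) |u|≡|v| (fibValue-bound u nco)) (m≤m+n _ _)

run-lessThan-decided : ∀ r W → run lessThan (just r) W ≡ just r
run-lessThan-decided r [] = refl
run-lessThan-decided r (_ ∷ W) = run-lessThan-decided r W

compare-run : ∀ W → NoConsecOnes (map proj₁ W) → NoConsecOnes (map proj₂ W) →
              Compared (run lessThan nothing W) (fibValue (map proj₁ W)) (fibValue (map proj₂ W))
compare-run [] _ _ = refl
compare-run ((false , false) ∷ W) nco₁ nco₂ = compare-run W nco₁ nco₂
compare-run ((true , true) ∷ W) nco₁ nco₂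
  rewrite length-map proj₁ W | length-map proj₂ W =
  +-compared (run lessThan nothing W) (fib (length W + 2))
    (compare-run W (NoConsecOnes-tail true (map proj₁ W) nco₁) (NoConsecOnes-tail true (map proj₂ W) nco₂))
compare-run ((false , true) ∷ W) nco₁ _ rewrite run-lessThan-decided true W =
  below-leading-one (map proj₁ W) (map proj₂ W) (length-map-proj W) nco₁
compare-run ((true , false) ∷ W) _ nco₂ rewrite run-lessThan-decided false W =
  below-leading-one (map proj₂ W) (map proj₁ W) (sym (length-map-proj W)) nco₂

recognizes-< : Recognizes lessThan _<_
recognizes-< W nco₁ nco₂ with run lessThan nothing W | compare-run W nco₁ nco₂
... | just true | lt = mk⇔ (λ _ → lt) (λ _ → tt)
... | just false | gt = mk⇔ (λ ()) (λ lt → ⊥-elim (<-asym lt gt))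
... | nothing | eq = mk⇔ (λ ()) (λ lt → ⊥-elim (<-irrefl eq lt))

dropZeros : List Bool → List Bool
dropZeros = dropWhileᵇ not

length-dropZeros : ∀ w → length (dropZeros w) ≤ length w
length-dropZeros [] = z≤n
length-dropZeros (false ∷ w) = m≤n⇒m≤1+n (length-dropZeros w)
length-dropZeros (true ∷ w) = ≤-refl

pad-dropZeros : ∀ w → pad (length w) (dropZeros w) ≡ w
pad-dropZeros [] = refl
pad-dropZeros (true ∷ w) = cong (λ k → replicate k false ++ true ∷ w) (n∸n≡0 (length w))
pad-dropZeros (false ∷ w) =
  trans (cong (λ k → replicate k false ++ dropZeros w) (+-∸-assoc 1 (length-dropZeros w)))
        (cong (false ∷_) (pad-dropZeros w))

dropZeros-zeckendorf : ∀ w {n} → Represents w n → IsZeck (dropZeros w) n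
dropZeros-zeckendorf [] rep = tt , rep
dropZeros-zeckendorf (true ∷ w) rep = refl , rep
dropZeros-zeckendorf (false ∷ w) rep = dropZeros-zeckendorf w rep

-- The last hypothesis says that u or v begins with a 1.
accepts-dropZeros : ∀ A u v → length u ≡ length v → length (dropZeros u) ⊔ length (dropZeros v) ≡ length u →
                    accepts A (dropZeros u) (dropZeros v) ≡ DFA.final A (runDFA A (DFA.start A) u v)
accepts-dropZeros A u v |u|≡|v| longest = cong (DFA.final A) (begin
  runDFA A (DFA.start A) (pad L (dropZeros u)) (pad L (dropZeros v))
    ≡⟨ cong (λ l → runDFA A (DFA.start A) (pad l (dropZeros u)) (pad l (dropZeros v))) longest ⟩
  runDFA A (DFA.start A) (pad (length u) (dropZeros u)) (pad (length u) (dropZeros v))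
    ≡⟨ cong₂ (runDFA A (DFA.start A)) (pad-dropZeros u)
             (trans (cong (λ l → pad l (dropZeros v)) |u|≡|v|) (pad-dropZeros v)) ⟩
  runDFA A (DFA.start A) u v ∎)
  where
    open ≡-Reasoning
    L : ℕ
    L = length (dropZeros u) ⊔ length (dropZeros v)

-- State nothing: only (0,0) has been read.  Skipping this padding makes acceptance independent of
-- how far the input is padded, whereas A is only specified on the minimal padding.
graph : DFA → Automaton (Bool × Bool)
graph A = record
  { State = Maybe (Fin (DFA.Q A))
  ; states = maybe-enumeration (fin-enumeration _)
  ; initial = nothing
  ; step = λ { nothing (false , false) → nothing ; nothing (a , b) → just (DFA.δ A (DFA.start A) a b)
             ; (just q) (a , b) → just (DFA.δ A q a b) }
  ; accepting = maybe (DFA.final A) (DFA.final A (DFA.start A)) }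

run-graph-started : ∀ A q W → run (graph A) (just q) W ≡ just (runDFA A q (map proj₁ W) (map proj₂ W))
run-graph-started A q [] = refl
run-graph-started A q ((a , b) ∷ W) = run-graph-started A (DFA.δ A q a b) W

accepts?-graph : ∀ A W → accepts? (graph A) W ≡ accepts A (dropZeros (map proj₁ W)) (dropZeros (map proj₂ W))
accepts?-graph A [] = refl
accepts?-graph A ((false , false) ∷ W) = accepts?-graph A W
accepts?-graph A ((true , b) ∷ W) rewrite run-graph-started A (DFA.δ A (DFA.start A) true b) W =
  sym (accepts-dropZeros A (true ∷ map proj₁ W) (b ∷ map proj₂ W) (cong suc (length-map-proj W))
        (m≥n⇒m⊔n≡m (≤-trans (length-dropZeros (b ∷ map proj₂ W)) (s≤s (≤-reflexive (sym (length-map-proj W)))))))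
accepts?-graph A ((false , true) ∷ W) rewrite run-graph-started A (DFA.δ A (DFA.start A) false true) W =
  sym (accepts-dropZeros A (false ∷ map proj₁ W) (true ∷ map proj₂ W) (cong suc (length-map-proj W))
        (trans (m≤n⇒m⊔n≡n (≤-trans (length-dropZeros (false ∷ map proj₁ W)) (s≤s (≤-reflexive (length-map-proj W)))))
               (cong suc (sym (length-map-proj W)))))

recognizes-graph : ∀ A s → Synchronized A s → Recognizes (graph A) (λ n x → x ≡ s n)
recognizes-graph A s sync W nco₁ nco₂ rewrite accepts?-graph A W =
  ⇔.trans T-≡ (sync _ _ _ _ (dropZeros-zeckendorf (map proj₁ W) (nco₁ , refl))
                            (dropZeros-zeckendorf (map proj₂ W) (nco₂ , refl)))

recognizes-on-tracks : ∀ {L} B R → Recognizes B R → (f g : L → Bool) →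
                       ∀ W → NoConsecOnes (map f W) → NoConsecOnes (map g W) →
                       T (accepts? (comap < f , g > B) W) ⇔ R (fibValue (map f W)) (fibValue (map g W))
recognizes-on-tracks B R rec f g W nco₁ nco₂ rewrite accepts?-comap < f , g > B W =
  subst₂ (λ u v → T (accepts? B (map < f , g > W)) ⇔ R (fibValue u) (fibValue v)) (sym (map-∘ W)) (sym (map-∘ W))
    (rec (map < f , g > W) (subst NoConsecOnes (map-∘ W) nco₁) (subst NoConsecOnes (map-∘ W) nco₂))

infixr 6 _∧ᶠ_
infixr 5 _⇒ᶠ_

data Formula (Atom V : Set) : Set where
  _⟨_⟩_     : V → Atom → V → Formula Atom V
  _∧ᶠ_ _⇒ᶠ_ : Formula Atom V → Formula Atom V → Formula Atom V

⟦_⟧ : ∀ {Atom V} → Formula Atom V → (Atom → ℕ → ℕ → Set) → (V → ℕ) → Set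
⟦ x ⟨ a ⟩ y ⟧ R ρ = R a (ρ x) (ρ y)
⟦ φ ∧ᶠ ψ ⟧ R ρ = ⟦ φ ⟧ R ρ × ⟦ ψ ⟧ R ρ
⟦ φ ⇒ᶠ ψ ⟧ R ρ = ⟦ φ ⟧ R ρ → ⟦ ψ ⟧ R ρ

module _ {Atom V L : Set} (automatonOf : Atom → Automaton (Bool × Bool)) (bit : V → L → Bool) where

  compile : Formula Atom V → Automaton L
  compile (x ⟨ a ⟩ y) = comap < bit x , bit y > (automatonOf a)
  compile (φ ∧ᶠ ψ) = compile φ ∩ compile ψ
  compile (φ ⇒ᶠ ψ) = compile φ ⇒ compile ψ

  compile-correct : ∀ {R} → (∀ a → Recognizes (automatonOf a) (R a)) →
                    ∀ φ W (ρ : V → ℕ) → (∀ x → Represents (map (bit x) W) (ρ x)) →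
                    T (accepts? (compile φ) W) ⇔ ⟦ φ ⟧ R ρ
  compile-correct {R} rec (x ⟨ a ⟩ y) W ρ reps =
    subst₂ (λ u v → _ ⇔ R a u v) (proj₂ (reps x)) (proj₂ (reps y))
      (recognizes-on-tracks (automatonOf a) (R a) (rec a) (bit x) (bit y) W (proj₁ (reps x)) (proj₁ (reps y)))
  compile-correct rec (φ ∧ᶠ ψ) W ρ reps =
    ⇔.trans (T-accepts?-∩ (compile φ) (compile ψ) W)
            (compile-correct rec φ W ρ reps ×-⇔ compile-correct rec ψ W ρ reps)
  compile-correct rec (φ ⇒ᶠ ψ) W ρ reps =
    ⇔.trans (T-accepts?-⇒ (compile φ) (compile ψ) W)
            (→-cong-⇔ (compile-correct rec φ W ρ reps) (compile-correct rec ψ W ρ reps))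

Represents-pad : ∀ k {w n} → Represents w n → Represents (replicate k false ++ w) n
Represents-pad zero rep = rep
Represents-pad (suc k) rep = Represents-pad k rep

module _ {A B : Set} where

  zip-aligned : ∀ (xs : List A) (ys : List B) → length xs ≡ length ys →
                ∃ λ W → map proj₁ W ≡ xs × map proj₂ W ≡ ys
  zip-aligned [] [] _ = [] , refl , refl
  zip-aligned (x ∷ xs) (y ∷ ys) eq =
    let W , eq₁ , eq₂ = zip-aligned xs ys (suc-injective eq) in (x , y) ∷ W , cong (x ∷_) eq₁ , cong (y ∷_) eq₂

  zip-padded : ∀ (a : A) (b : B) xs ys →
               ∃ λ W → map proj₁ W ≡ replicate (length ys) a ++ xs × map proj₂ W ≡ replicate (length xs) b ++ ys
  zip-padded a b xs ys = zip-aligned _ _ (begin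
    length (replicate (length ys) a ++ xs)   ≡⟨ length-++ (replicate (length ys) a) ⟩
    length (replicate (length ys) a) + length xs ≡⟨ cong (_+ length xs) (length-replicate (length ys)) ⟩
    length ys + length xs                    ≡⟨ +-comm (length ys) (length xs) ⟩
    length xs + length ys                    ≡⟨ cong (_+ length ys) (length-replicate (length xs)) ⟨
    length (replicate (length xs) b) + length ys ≡⟨ length-++ (replicate (length xs) b) ⟨
    length (replicate (length xs) b ++ ys)   ∎)
    where open ≡-Reasoning

zeros : ∀ d → Vec Bool d
zeros d = Vec.replicate d false

column : ∀ {L : Set} {d} → (L → Vec Bool d) → Fin d → List L → List Bool
column f i = map (λ l → Vec.lookup (f l) i)

Encodes : ∀ {d} → List (Vec Bool d) → Vec ℕ d → Set
Encodes Us xs = ∀ i → Represents (column id i Us) (Vec.lookup xs i)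

decode : ∀ {d} → List (Vec Bool d) → Vec ℕ d
decode Us = tabulate λ i → fibValue (column id i Us)

column-map : ∀ {L d} (f : L → Vec Bool d) i W → column id i (map f W) ≡ column f i W
column-map f i W = sym (map-∘ W)

column-padded : ∀ {L d} (f : L → Vec Bool d) i k W Us → map f W ≡ replicate k (zeros d) ++ Us →
                column f i W ≡ replicate k false ++ column id i Us
column-padded {d = d} f i k W Us eq = begin
  column f i W
    ≡⟨ column-map f i W ⟨
  column id i (map f W)
    ≡⟨ cong (column id i) eq ⟩
  column id i (replicate k (zeros d) ++ Us)
    ≡⟨ map-++ _ (replicate k (zeros d)) Us ⟩
  column id i (replicate k (zeros d)) ++ column id i Us
    ≡⟨ cong (_++ column id i Us) (map-replicate _ k (zeros d)) ⟩
  replicate k (Vec.lookup (zeros d) i) ++ column id i Us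
    ≡⟨ cong (λ b → replicate k b ++ column id i Us) (lookup-replicate i false) ⟩
  replicate k false ++ column id i Us ∎
  where open ≡-Reasoning

padded-encodes : ∀ {L d} (f : L → Vec Bool d) k W Us xs → map f W ≡ replicate k (zeros d) ++ Us → Encodes Us xs →
                 ∀ i → Represents (column f i W) (Vec.lookup xs i)
padded-encodes f k W Us xs eq enc i =
  subst (λ w → Represents w _) (sym (column-padded f i k W Us eq)) (Represents-pad k (enc i))

encode : ∀ {d} (xs : Vec ℕ d) → ∃ λ Us → Encodes Us xs
encode [] = [] , λ ()
encode {suc d} (x ∷ xs) with represent x | encode xs
... | w , w-x | Us , Us-xs with zip-padded false (zeros d) w Us
... | Z , eq₁ , eq₂ = map (uncurry _∷_) Z , encodes
  where
    encodes : Encodes (map (uncurry _∷_) Z) (x ∷ xs)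
    encodes Fin.zero = subst (λ w → Represents w x) (sym (trans (column-map (uncurry _∷_) Fin.zero Z) eq₁))
                             (Represents-pad (length Us) w-x)
    encodes (Fin.suc i) = subst (λ w → Represents w _) (sym (column-map (uncurry _∷_) (Fin.suc i) Z))
                                (padded-encodes proj₂ (length w) Z Us xs eq₂ Us-xs i)

everything : ∀ {L} → Automaton L
everything = record
  { State = ⊤ ; states = record { elements = tt ∷ [] ; complete = λ _ → here refl }
  ; initial = tt ; step = λ _ _ → tt ; accepting = λ _ → true }

columnsValid : ∀ d → Automaton (Vec Bool d)
columnsValid zero = everything
columnsValid (suc d) = comap (λ u → Vec.lookup u Fin.zero) noConsecOnes ∩ comap Vec.tail (columnsValid d)

all-NoConsecOnes-cong : ∀ {d} {u v : Fin d → List Bool} → (∀ i → u i ≡ v i) →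
                        (∀ i → NoConsecOnes (u i)) ⇔ (∀ i → NoConsecOnes (v i))
all-NoConsecOnes-cong eq = mk⇔ (λ nco i → subst NoConsecOnes (eq i) (nco i))
                               (λ nco i → subst NoConsecOnes (sym (eq i)) (nco i))

T-comap-noConsecOnes : ∀ {L} (f : L → Bool) W → T (accepts? (comap f noConsecOnes) W) ⇔ NoConsecOnes (map f W)
T-comap-noConsecOnes f W rewrite accepts?-comap f noConsecOnes W = T-noConsecOnes (map f W)

column-tail : ∀ {d} i (Us : List (Vec Bool (suc d))) → column id i (map Vec.tail Us) ≡ column id (Fin.suc i) Us
column-tail i Us = trans (column-map Vec.tail i Us) (map-cong (λ { (_ ∷ _) → refl }) Us)

T-columnsValid : ∀ d Us → T (accepts? (columnsValid d) Us) ⇔ (∀ i → NoConsecOnes (column id i Us))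
T-columnsValid zero Us = mk⇔ (λ _ ()) (λ _ → tt)
T-columnsValid (suc d) Us = begin
  T (accepts? (columnsValid (suc d)) Us)
    ≈⟨ T-accepts?-∩ (comap (λ u → Vec.lookup u Fin.zero) noConsecOnes) (comap Vec.tail (columnsValid d)) Us ⟩
  (T (accepts? (comap (λ u → Vec.lookup u Fin.zero) noConsecOnes) Us) × T (accepts? (comap Vec.tail (columnsValid d)) Us))
    ≈⟨ T-comap-noConsecOnes (λ u → Vec.lookup u Fin.zero) Us ×-⇔ tail-valid ⟩
  (NoConsecOnes (column id Fin.zero Us) × (∀ i → NoConsecOnes (column id (Fin.suc i) Us)))
    ≈⟨ ∀-cons-⇔ ⟩
  (∀ i → NoConsecOnes (column id i Us)) ∎
  where
    open SetoidReasoning (⇔.⇔-setoid 0ℓ)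
    tail-valid : T (accepts? (comap Vec.tail (columnsValid d)) Us) ⇔ (∀ i → NoConsecOnes (column id (Fin.suc i) Us))
    tail-valid rewrite accepts?-comap Vec.tail (columnsValid d) Us =
      ⇔.trans (T-columnsValid d (map Vec.tail Us)) (all-NoConsecOnes-cong λ i → column-tail i Us)

T-comap-columnsValid : ∀ {L d} (f : L → Vec Bool d) W →
                       T (accepts? (comap f (columnsValid d)) W) ⇔ (∀ i → NoConsecOnes (column f i W))
T-comap-columnsValid {d = d} f W rewrite accepts?-comap f (columnsValid d) W =
  ⇔.trans (T-columnsValid d (map f W)) (all-NoConsecOnes-cong λ i → column-map f i W)

Letter : ℕ → ℕ → Set
Letter m n = Vec Bool m × Vec Bool n

track : ∀ {m n} → Fin m ⊎ Fin n → Letter m n → Bool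
track (inj₁ i) l = Vec.lookup (proj₁ l) i
track (inj₂ j) l = Vec.lookup (proj₂ l) j

-- The variables inj₁ i are quantified universally, the variables inj₂ j existentially.
HoldsForAllExists : ∀ {Atom m n} → Formula Atom (Fin m ⊎ Fin n) → (Atom → ℕ → ℕ → Set) → Set
HoldsForAllExists {m = m} {n} φ R =
  ∀ (xs : Vec ℕ m) → ∃ λ (ys : Vec ℕ n) → ⟦ φ ⟧ R [ Vec.lookup xs , Vec.lookup ys ]

module ∀∃-Decision {Atom : Set} {m n}
  (automatonOf : Atom → Automaton (Bool × Bool)) (φ : Formula Atom (Fin m ⊎ Fin n)) where

  -- Words whose universal tracks are not valid representations are accepted vacuously.
  universalsValid existentialsValid matrix guarded : Automaton (Letter m n)
  universalsValid = comap proj₁ (columnsValid m)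
  existentialsValid = comap proj₂ (columnsValid n)
  matrix = compile automatonOf track φ
  guarded = universalsValid ⇒ (existentialsValid ∩ matrix)

  open Projection (vec-enumeration bool-enumeration m) (vec-enumeration bool-enumeration n) (zeros m) guarded
    using (PaddedAcceptance; ∀∃?; T-∀∃?)

  -- Opaque, so that checking the main theorem never tries to evaluate the decision procedure.
  opaque
    holds? : Bool
    holds? = ∀∃?

  module _ (R : Atom → ℕ → ℕ → Set) (rec : ∀ a → Recognizes (automatonOf a) (R a)) where

    padded⇒holds : (∀ Us → PaddedAcceptance Us) → HoldsForAllExists φ R
    padded⇒holds accepted xs with encode xs
    ... | Us , Us-xs with accepted Us
    ... | k , W , eq , acc = ys , to (compile-correct automatonOf track rec φ W _ reps) (proj₂ conclusion)
      where
        universal : ∀ i → Represents (column proj₁ i W) (Vec.lookup xs i)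
        universal = padded-encodes proj₁ k W Us xs eq Us-xs
        conclusion : T (accepts? existentialsValid W) × T (accepts? matrix W)
        conclusion = to (T-accepts?-∩ existentialsValid matrix W)
                        (to (T-accepts?-⇒ universalsValid (existentialsValid ∩ matrix) W) acc
                            (from (T-comap-columnsValid proj₁ W) (proj₁ ∘ universal)))
        ys : Vec ℕ n
        ys = tabulate λ j → fibValue (column proj₂ j W)
        reps : ∀ x → Represents (map (track x) W) ([ Vec.lookup xs , Vec.lookup ys ] x)
        reps (inj₁ i) = universal i
        reps (inj₂ j) = to (T-comap-columnsValid proj₂ W) (proj₁ conclusion) j , sym (lookup∘tabulate _ j)

    holds⇒padded : HoldsForAllExists φ R → ∀ Us → PaddedAcceptance Us
    holds⇒padded holds Us with T? (accepts? (columnsValid m) Us)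
    ... | no invalid =
      0 , W , unpadded , from (T-accepts?-⇒ universalsValid (existentialsValid ∩ matrix) W) (⊥-elim ∘ invalid ∘ valid)
      where
        W : List (Letter m n)
        W = map (_, zeros n) Us
        unpadded : map proj₁ W ≡ Us
        unpadded = trans (sym (map-∘ Us)) (map-id Us)
        valid : T (accepts? universalsValid W) → T (accepts? (columnsValid m) Us)
        valid acc = subst (T ∘ accepts? (columnsValid m)) unpadded (subst T (accepts?-comap proj₁ (columnsValid m) W) acc)
    ... | yes valid with holds (decode Us)
    ... | ys , φ-holds with encode ys
    ... | Vs , Vs-ys with zip-padded (zeros m) (zeros n) Us Vs
    ... | W , eq₁ , eq₂ = length Vs , W , eq₁ ,
          from (T-accepts?-⇒ universalsValid (existentialsValid ∩ matrix) W) λ _ →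
            from (T-accepts?-∩ existentialsValid matrix W)
              (from (T-comap-columnsValid proj₂ W) (proj₁ ∘ reps ∘ inj₂) ,
               from (compile-correct automatonOf track rec φ W _ reps) φ-holds)
      where
        Us-xs : Encodes Us (decode Us)
        Us-xs i = to (T-columnsValid m Us) valid i , sym (lookup∘tabulate _ i)
        reps : ∀ x → Represents (map (track x) W) ([ Vec.lookup (decode Us) , Vec.lookup ys ] x)
        reps (inj₁ i) = padded-encodes proj₁ (length Vs) W Us (decode Us) eq₁ Us-xs i
        reps (inj₂ j) = padded-encodes proj₂ (length Us) W Vs ys eq₂ Vs-ys j

    opaque
      unfolding holds?

      T-holds? : T holds? ⇔ HoldsForAllExists φ R
      T-holds? = ⇔.trans T-∀∃? (mk⇔ padded⇒holds holds⇒padded)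

module FirstOccurrences (s : ℕ → ℕ) where

  occursBefore-sound : ∀ v i → occursBefore s v i ≡ true → ∃ λ j → j < i × s j ≡ v
  occursBefore-sound v (suc i) occurs with s i ℕ.≟ v
  ... | yes si≡v = i , ≤-refl , si≡v
  ... | no _ = let j , j<i , sj≡v = occursBefore-sound v i occurs in j , m≤n⇒m≤1+n j<i , sj≡v

  occursBefore-complete : ∀ v i j → j < i → s j ≡ v → occursBefore s v i ≡ true
  occursBefore-complete v (suc i) j j<1+i sj≡v with s i ℕ.≟ v
  ... | yes _ = refl
  ... | no si≢v with m≤n⇒m<n∨m≡n (≤-pred j<1+i)
  ...   | inj₁ j<i = occursBefore-complete v i j j<i sj≡v
  ...   | inj₂ refl = ⊥-elim (si≢v sj≡v)

  FirstOcc⇔ : ∀ i → FirstOcc s i ⇔ occursBefore s (s i) i ≡ false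
  FirstOcc⇔ i = mk⇔ not-before first
    where
      not-before : FirstOcc s i → occursBefore s (s i) i ≡ false
      not-before first with occursBefore s (s i) i in eq
      ... | false = refl
      ... | true = let j , j<i , sj≡si = occursBefore-sound (s i) i eq in ⊥-elim (first j j<i sj≡si)
      first : occursBefore s (s i) i ≡ false → FirstOcc s i
      first not-before j j<i sj≡si with () ← trans (sym not-before) (occursBefore-complete (s i) i j j<i sj≡si)

  EarliestWithValueOf : ℕ → Set
  EarliestWithValueOf n = ∃ λ j → j ≤ n × s j ≡ s n × FirstOcc s j

  first-occurrence : ∀ n → EarliestWithValueOf n
  first-occurrence = <-rec EarliestWithValueOf earliest
    where
      earliest : ∀ n → (∀ {j} → j < n → EarliestWithValueOf j) → EarliestWithValueOf n
      earliest n earlier with occursBefore s (s n) n in eq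
      ... | false = n , ≤-refl , refl , from (FirstOcc⇔ n) eq
      ... | true with occursBefore-sound (s n) n eq
      ... | j , j<n , sj≡sn with earlier j<n
      ... | i , i≤j , si≡sj , first = i , ≤-trans i≤j (<⇒≤ j<n) , trans si≡sj sj≡sn , first

  FirstOcc-injective : ∀ {i j} → FirstOcc s i → FirstOcc s j → s i ≡ s j → i ≡ j
  FirstOcc-injective {i} {j} first-i first-j si≡sj with <-cmp i j
  ... | tri< i<j _ _ = ⊥-elim (first-j i i<j si≡sj)
  ... | tri≈ _ i≡j _ = i≡j
  ... | tri> _ _ j<i = ⊥-elim (first-i j j<i (sym si≡sj))

  countNew-step : ∀ i → countNew s i ≤ countNew s (suc i)
  countNew-step i with occursBefore s (s i) i
  ... | true = ≤-refl
  ... | false = n≤1+n _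

  countNew-first : ∀ {i} → FirstOcc s i → countNew s (suc i) ≡ suc (countNew s i)
  countNew-first {i} first rewrite to (FirstOcc⇔ i) first = refl

  countNew-mono : ∀ {i j} → i ≤ j → countNew s i ≤ countNew s j
  countNew-mono i≤j = go (≤⇒≤′ i≤j)
    where
      go : ∀ {i j} → i ≤′ j → countNew s i ≤ countNew s j
      go ≤′-refl = ≤-refl
      go (≤′-step {j} i≤′j) = ≤-trans (go i≤′j) (countNew-step j)

  countNew-strict : ∀ {i j} → FirstOcc s i → i < j → countNew s i < countNew s j
  countNew-strict first i<j = ≤-trans (≤-reflexive (sym (countNew-first first))) (countNew-mono i<j)

  countNew-injective : ∀ {i j} → FirstOcc s i → FirstOcc s j → countNew s i ≡ countNew s j → i ≡ j
  countNew-injective {i} {j} first-i first-j same with <-cmp i j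
  ... | tri< i<j _ _ = ⊥-elim (<-irrefl same (countNew-strict first-i i<j))
  ... | tri≈ _ i≡j _ = i≡j
  ... | tri> _ _ j<i = ⊥-elim (<-irrefl (sym same) (countNew-strict first-j j<i))

  countNew-flat : ∀ {i j} → i ≤ j → (∀ m → i ≤ m → m < j → ¬ FirstOcc s m) → countNew s j ≡ countNew s i
  countNew-flat i≤j = go (≤⇒≤′ i≤j)
    where
      go : ∀ {i j} → i ≤′ j → (∀ m → i ≤ m → m < j → ¬ FirstOcc s m) → countNew s j ≡ countNew s i
      go ≤′-refl _ = refl
      go {i} (≤′-step {j} i≤′j) none with occursBefore s (s j) j in eq
      ... | true = go i≤′j λ m i≤m m<j → none m i≤m (m≤n⇒m≤1+n m<j)
      ... | false = ⊥-elim (none j (≤′⇒≤ i≤′j) ≤-refl (from (FirstOcc⇔ j) eq))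

ValuesIn : (ℕ → ℕ) → (ℕ → ℕ) → Set
ValuesIn f g = ∀ n → ∃ λ k → g k ≡ f n

OccursInOrder : (ℕ → ℕ) → (ℕ → ℕ) → Set
OccursInOrder s s' = ∀ k k' n' → k < k' → s n' ≡ s' k' → ∃ λ n → n < n' × s n ≡ s' k

module _ (s s' : ℕ → ℕ) where
  open FirstOccurrences s

  transform⇒conditions : IsDistinctnessTransform s s' → ValuesIn s s' × ValuesIn s' s × OccursInOrder s s'
  transform⇒conditions transform = covered , attained , in-order
    where
      attained : ValuesIn s' s
      attained k = let i , _ , _ , s'k≡si = transform k in i , sym s'k≡si
      covered : ValuesIn s s'
      covered n with first-occurrence n
      ... | j , _ , sj≡sn , first-j with transform (countNew s j)
      ... | i , first-i , same-count , s'k≡si =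
        countNew s j , trans s'k≡si (trans (cong s (countNew-injective first-i first-j same-count)) sj≡sn)
      in-order : OccursInOrder s s'
      in-order k k' n' k<k' sn'≡s'k' with transform k | transform k'
      ... | i , _ , count-i , s'k≡si | i' , first-i' , count-i' , s'k'≡si' = i , <-≤-trans i<i' i'≤n' , sym s'k≡si
        where
          i'≤n' : i' ≤ n'
          i'≤n' = ≮⇒≥ λ n'<i' → first-i' n' n'<i' (trans sn'≡s'k' s'k'≡si')
          i<i' : i < i'
          i<i' = ≰⇒> λ i'≤i → <⇒≱ k<k' (subst₂ _≤_ count-i' count-i (countNew-mono i'≤i))

  module _ (covered : ValuesIn s s') (attained : ValuesIn s' s) (in-order : OccursInOrder s s') where

    position : ℕ → ℕ
    position k = proj₁ (first-occurrence (proj₁ (attained k)))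

    position-value : ∀ k → s (position k) ≡ s' k
    position-value k = trans (proj₁ (proj₂ (proj₂ (first-occurrence (proj₁ (attained k)))))) (proj₂ (attained k))

    position-first : ∀ k → FirstOcc s (position k)
    position-first k = proj₂ (proj₂ (proj₂ (first-occurrence (proj₁ (attained k)))))

    position-strict : ∀ {k k'} → k < k' → position k < position k'
    position-strict {k} {k'} k<k' with in-order k k' (position k') k<k' (position-value k')
    ... | n , n<pk' , sn≡s'k =
      ≤-<-trans (≮⇒≥ λ n<pk → position-first k n n<pk (trans sn≡s'k (sym (position-value k)))) n<pk'

    position-reflects : ∀ {k k'} → position k < position k' → k < k'
    position-reflects {k} {k'} pk<pk' with <-cmp k k'
    ... | tri< k<k' _ _ = k<k'
    ... | tri≈ _ refl _ = ⊥-elim (<-irrefl refl pk<pk')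
    ... | tri> _ _ k'<k = ⊥-elim (<-asym pk<pk' (position-strict k'<k))

    position-onto : ∀ m → FirstOcc s m → ∃ λ k → position k ≡ m
    position-onto m first =
      let k , s'k≡sm = covered m in k , FirstOcc-injective (position-first k) first (trans (position-value k) s'k≡sm)

    position-count : ∀ k → countNew s (position k) ≡ k
    position-count zero = countNew-flat z≤n λ m _ m<p0 first →
      let k , pk≡m = position-onto m first in n≮0 (position-reflects (subst (_< position 0) (sym pk≡m) m<p0))
    position-count (suc k) = begin
      countNew s (position (suc k))   ≡⟨ countNew-flat (position-strict (n<1+n k)) none-between ⟩
      countNew s (suc (position k))   ≡⟨ countNew-first (position-first k) ⟩
      suc (countNew s (position k))   ≡⟨ cong suc (position-count k) ⟩
      suc k                           ∎
      where
        open ≡-Reasoning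
        none-between : ∀ m → suc (position k) ≤ m → m < position (suc k) → ¬ FirstOcc s m
        none-between m pk<m m<pk+1 first with position-onto m first
        ... | k'' , refl = <-irrefl refl (<-≤-trans (position-reflects pk<m) (≤-pred (position-reflects m<pk+1)))

    conditions⇒transform : IsDistinctnessTransform s s'
    conditions⇒transform k = position k , position-first k , position-count k , sym (position-value k)

  transform⇔conditions : IsDistinctnessTransform s s' ⇔ (ValuesIn s s' × ValuesIn s' s × OccursInOrder s s')
  transform⇔conditions =
    mk⇔ transform⇒conditions λ (covered , attained , in-order) → conditions⇒transform covered attained in-order

data Atom : Set where
  graph-s graph-s' less : Atom

atomAutomaton : DFA → DFA → Atom → Automaton (Bool × Bool)
atomAutomaton A A' graph-s = graph A
atomAutomaton A A' graph-s' = graph A'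
atomAutomaton A A' less = lessThan

atomRelation : (ℕ → ℕ) → (ℕ → ℕ) → Atom → ℕ → ℕ → Set
atomRelation s s' graph-s n x = x ≡ s n
atomRelation s s' graph-s' n x = x ≡ s' n
atomRelation s s' less = _<_

atoms-recognized : ∀ {A A' s s'} → Synchronized A s → Synchronized A' s' →
                   ∀ a → Recognizes (atomAutomaton A A' a) (atomRelation s s' a)
atoms-recognized {A} {s = s} sync _ graph-s = recognizes-graph A s sync
atoms-recognized {A' = A'} {s' = s'} _ sync' graph-s' = recognizes-graph A' s' sync'
atoms-recognized _ _ less = recognizes-<

values-covered : Formula Atom (Fin 1 ⊎ Fin 2)
values-covered = (n ⟨ graph-s ⟩ v) ∧ᶠ (k ⟨ graph-s' ⟩ v)
  where
    n k v : Fin 1 ⊎ Fin 2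
    n = inj₁ Fin.zero
    k = inj₂ Fin.zero
    v = inj₂ (Fin.suc Fin.zero)

values-attained : Formula Atom (Fin 1 ⊎ Fin 2)
values-attained = (k ⟨ graph-s' ⟩ v) ∧ᶠ (n ⟨ graph-s ⟩ v)
  where
    k n v : Fin 1 ⊎ Fin 2
    k = inj₁ Fin.zero
    n = inj₂ Fin.zero
    v = inj₂ (Fin.suc Fin.zero)

occurs-in-order : Formula Atom (Fin 4 ⊎ Fin 2)
occurs-in-order =
  (k ⟨ less ⟩ k' ∧ᶠ n' ⟨ graph-s ⟩ v' ∧ᶠ k' ⟨ graph-s' ⟩ v') ⇒ᶠ
  (n ⟨ less ⟩ n' ∧ᶠ n ⟨ graph-s ⟩ v ∧ᶠ k ⟨ graph-s' ⟩ v)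
  where
    k k' n' v' n v : Fin 4 ⊎ Fin 2
    k = inj₁ Fin.zero
    k' = inj₁ (Fin.suc Fin.zero)
    n' = inj₁ (Fin.suc (Fin.suc Fin.zero))
    v' = inj₁ (Fin.suc (Fin.suc (Fin.suc Fin.zero)))
    n = inj₂ Fin.zero
    v = inj₂ (Fin.suc Fin.zero)

module _ (s s' : ℕ → ℕ) where

  values-covered-holds : HoldsForAllExists values-covered (atomRelation s s') ⇔ ValuesIn s s'
  values-covered-holds = mk⇔ covered holds
    where
      covered : HoldsForAllExists values-covered (atomRelation s s') → ValuesIn s s'
      covered holds n with holds (n ∷ [])
      ... | (k ∷ _ ∷ []) , v≡sn , v≡s'k = k , trans (sym v≡s'k) v≡sn
      holds : ValuesIn s s' → HoldsForAllExists values-covered (atomRelation s s')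
      holds covered (n ∷ []) = let k , s'k≡sn = covered n in (k ∷ s n ∷ []) , refl , sym s'k≡sn

  values-attained-holds : HoldsForAllExists values-attained (atomRelation s s') ⇔ ValuesIn s' s
  values-attained-holds = mk⇔ attained holds
    where
      attained : HoldsForAllExists values-attained (atomRelation s s') → ValuesIn s' s
      attained holds k with holds (k ∷ [])
      ... | (n ∷ _ ∷ []) , v≡s'k , v≡sn = n , trans (sym v≡sn) v≡s'k
      holds : ValuesIn s' s → HoldsForAllExists values-attained (atomRelation s s')
      holds attained (k ∷ []) = let n , sn≡s'k = attained k in (n ∷ s' k ∷ []) , refl , sym sn≡s'k

  occurs-in-order-holds : HoldsForAllExists occurs-in-order (atomRelation s s') ⇔ OccursInOrder s s'
  occurs-in-order-holds = mk⇔ in-order holds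
    where
      in-order : HoldsForAllExists occurs-in-order (atomRelation s s') → OccursInOrder s s'
      in-order holds k k' n' k<k' sn'≡s'k' with holds (k ∷ k' ∷ n' ∷ s n' ∷ [])
      ... | (n ∷ _ ∷ []) , implication =
        let n<n' , v≡sn , v≡s'k = implication (k<k' , refl , sn'≡s'k') in n , n<n' , trans (sym v≡sn) v≡s'k
      holds : OccursInOrder s s' → HoldsForAllExists occurs-in-order (atomRelation s s')
      holds in-order (k ∷ k' ∷ n' ∷ v' ∷ []) with (k <? k') ×-dec (v' ℕ.≟ s n') ×-dec (v' ℕ.≟ s' k')
      ... | no premise-fails = (0 ∷ 0 ∷ []) , ⊥-elim ∘ premise-fails
      ... | yes (k<k' , refl , v'≡s'k') =
        let n , n<n' , sn≡s'k = in-order k k' n' k<k' v'≡s'k' in (n ∷ s n ∷ []) , λ _ → n<n' , refl , sn≡s'k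

decide : DFA → DFA → Bool
decide A A' = holds? values-covered ∧ holds? values-attained ∧ holds? occurs-in-order
  where
    holds? : ∀ {m n} → Formula Atom (Fin m ⊎ Fin n) → Bool
    holds? = ∀∃-Decision.holds? (atomAutomaton A A')

module _ {A A' s s'} (sync : Synchronized A s) (sync' : Synchronized A' s') where

  T-holds? : ∀ {m n} (φ : Formula Atom (Fin m ⊎ Fin n)) →
             T (∀∃-Decision.holds? (atomAutomaton A A') φ) ⇔ HoldsForAllExists φ (atomRelation s s')
  T-holds? φ = ∀∃-Decision.T-holds? (atomAutomaton A A') φ (atomRelation s s') (atoms-recognized sync sync')

  T-decide : T (decide A A') ⇔ (ValuesIn s s' × ValuesIn s' s × OccursInOrder s s')
  T-decide = ⇔.trans T-∧ (⇔.trans (T-holds? values-covered) (values-covered-holds s s') ×-⇔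
             ⇔.trans T-∧ (⇔.trans (T-holds? values-attained) (values-attained-holds s s') ×-⇔
                          ⇔.trans (T-holds? occurs-in-order) (occurs-in-order-holds s s')))

theorem18 : Σ (DFA → DFA → Bool) λ decide →
              ∀ (A A' : DFA) (s s' : ℕ → ℕ) →
              Synchronized A s → Synchronized A' s' →
              (decide A A' ≡ true ⇔ IsDistinctnessTransform s s')
theorem18 = decide , λ A A' s s' sync sync' →
  ⇔.trans (⇔.sym T-≡) (⇔.trans (T-decide sync sync') (⇔.sym (transform⇔conditions s s')))
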